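{- Let $n\ge1$ and regard the symmetric group $\mathfrak S_n$ as the set of words of length $n$ whose letters are $1,2,\ldots,n$, each appearing once. Then each basement lift map $B_i$ ($i\in\mathbb{Z}_+$) restricts to a bijection $B_i:\mathfrak S_n\to\mathfrak S_n$. Moreover, for every $w\in\mathfrak S_n$ and every $k\in\mathbb{Z}_{\ge0}$, \[ \operatorname{inv}^k(w)=\operatorname{inv}^{k+1}(B_{k+1}(w)),\qquad \operatorname{inv}(w)=\operatorname{inv}(B_{0\to n}(w)), \] where $B_{0\to n}=B_n\circ B_{n-1}\circ\cdots\circ B_2\circ B_1$ and $\operatorname{inv}(w)$ is the number of pairs $i<j$ with $w_i>w_j$.
   Context: For a word $w=w_1\cdots w_n$ over the positive integers and $k\in\mathbb{Z}_{\ge0}$, a relative $k$-inversion is a pair $(i,j)$ with $i<j$ such that either $k\ge w_i>w_j$, or $w_i>w_j>k$, or $w_j>k\ge w_i$; $\operatorname{inv}^k(w)$ denotes their number. For $i\in\mathbb{Z}_+$, the basement lift map $B_i$ on words of length $n$ is defined by: $(B_i(w))_j=i$ if and only if $w_{n+1-j}=i$, and the subword of letters not equal to $i$ is the same in $w$ and in $B_i(w)$. -}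

module Defs where

open import Data.Nat using (ℕ; zero; suc; _+_; _≤ᵇ_; _<ᵇ_; _≡ᵇ_)
open import Data.Bool using (Bool; true; false; _∧_; _∨_; if_then_else_; not; T?)
open import Data.List using (List; []; _∷_; reverse; filter; map; upTo)
open import Data.List.Relation.Binary.Permutation.Propositional using (_↭_)
open import Data.Product using (Σ; _×_)
open import Relation.Binary.PropositionalEquality using (_≡_)

-- Words over the positive integers are lists of naturals; position 1 is the head.

countB : (ℕ → Bool) → List ℕ → ℕ
countB p [] = 0
countB p (y ∷ ys) = (if p y then 1 else 0) + countB p ys

relInvB : ℕ → ℕ → ℕ → Bool
relInvB k x y = ((x ≤ᵇ k) ∧ (y <ᵇ x)) ∨ ((y <ᵇ x) ∧ (k <ᵇ y)) ∨ ((k <ᵇ y) ∧ (x ≤ᵇ k))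

invK : ℕ → List ℕ → ℕ
invK k [] = 0
invK k (x ∷ xs) = countB (relInvB k x) xs + invK k xs

inv : List ℕ → ℕ
inv [] = 0
inv (x ∷ xs) = countB (λ y → y <ᵇ x) xs + inv xs

-- helper: walk through the pattern p = reverse w; at position j, if
-- p_j = w_{n+1-j} = i output i, otherwise output the next letter of the
-- subword `rest` of letters of w different from i.
fillB : ℕ → List ℕ → List ℕ → List ℕ
fillB i [] rest = []
fillB i (x ∷ xs) rest with x ≡ᵇ i
... | true = i ∷ fillB i xs rest
... | false with rest
...   | [] = []          -- unreachable: counts always match
...   | (y ∷ ys) = y ∷ fillB i xs ys

B : ℕ → List ℕ → List ℕ
B i w = fillB i (reverse w) (filter (λ x → T? (not (x ≡ᵇ i))) w)

Bupto : ℕ → List ℕ → List ℕ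
Bupto zero w = w
Bupto (suc m) w = B (suc m) (Bupto m w)

IsPerm : ℕ → List ℕ → Set
IsPerm n w = w ↭ map suc (upTo n)

-- In a word with distinct letters, B i is the identity when i does not occur, and otherwise it
-- moves the single letter i from position p to the mirrored position n + 1 − p while keeping the
-- other letters in order; applying it twice restores the word, so B i is an involutive
-- permutation of 𝔖ₙ. Relative k- and (k+1)-inversions agree on pairs avoiding k + 1, while k + 1
-- forms a relative k-inversion with exactly the letters before it and a relative (k+1)-inversion
-- with exactly the letters after it, and B (k + 1) exchanges these two counts. Finally inv⁰ and
-- invⁿ both coincide with inv on 𝔖ₙ, so chaining the first identity gives the second.
module Submission where

open import Defs
open import Data.Bool using (Bool; true; false; _∧_; _∨_; not; T; if_then_else_)
open import Data.Bool.Properties using (T-not-≡)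
open import Data.List using (List; []; _∷_; _++_; length; reverse; filter; map; upTo; [_])
open import Data.List.Properties using (length-++; length-reverse; reverse-++; unfold-reverse; ++-assoc; filter-++; filter-all; filter-reject)
open import Data.List.Membership.Propositional using (_∈_)
open import Data.List.Membership.Propositional.Properties using (∈-∃++; ∈-map⁻; ∈-upTo⁻)
open import Data.List.Relation.Binary.Permutation.Propositional using (_↭_; ↭-sym; ↭-trans; ↭-reflexive; ↭⇒↭ₛ; module PermutationReasoning)
open import Data.List.Relation.Binary.Permutation.Propositional.Properties using (All-resp-↭; shift; ↭-reverse)
open import Data.List.Relation.Binary.Permutation.Setoid.Properties using (Unique-resp-↭)
open import Data.List.Relation.Unary.All as All using (All; []; _∷_)
open import Data.List.Relation.Unary.All.Properties using (¬Any⇒All¬; ++⁻ˡ; ++⁻ʳ)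
open import Data.List.Relation.Unary.AllPairs using (_∷_)
open import Data.List.Relation.Unary.Unique.Propositional using (Unique)
open import Data.List.Relation.Unary.Unique.Propositional.Properties using (upTo⁺) renaming (map⁺ to Unique-map⁺)
open import Data.Nat using (ℕ; zero; suc; _+_; _≤_; _<_; _≤ᵇ_; _<ᵇ_; _≡ᵇ_; z≤n; s≤s)
open import Data.Nat.Properties
open import Data.List.Membership.DecPropositional _≟_ using (_∈?_)
open import Data.Nat.Solver using (module +-*-Solver)
open import Data.Product using (Σ; _×_; _,_; proj₁; proj₂; ∃₂)
open import Data.Sum using (_⊎_; inj₁; inj₂)
open import Function using (_∘_; Equivalence)
open import Relation.Binary.PropositionalEquality using (_≡_; _≢_; refl; sym; trans; cong; cong₂; subst; setoid; module ≡-Reasoning)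
open import Relation.Nullary using (¬_; Dec; yes; no)
open import Relation.Nullary.Decidable using (T?)
open import Relation.Nullary.Reflects using (ofʸ; ofⁿ; det; T-reflects)

<ᵇ-true : ∀ {m n} → m < n → (m <ᵇ n) ≡ true
<ᵇ-true {m} {n} m<n = det (<ᵇ-reflects-< m n) (ofʸ m<n)

<ᵇ-false : ∀ {m n} → n ≤ m → (m <ᵇ n) ≡ false
<ᵇ-false {m} {n} n≤m = det (<ᵇ-reflects-< m n) (ofⁿ (≤⇒≯ n≤m))

≤ᵇ-true : ∀ {m n} → m ≤ n → (m ≤ᵇ n) ≡ true
≤ᵇ-true {m} {n} m≤n = det (≤ᵇ-reflects-≤ m n) (ofʸ m≤n)

≤ᵇ-false : ∀ {m n} → n < m → (m ≤ᵇ n) ≡ false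
≤ᵇ-false {m} {n} n<m = det (≤ᵇ-reflects-≤ m n) (ofⁿ (<⇒≱ n<m))

≡ᵇ-refl : ∀ n → (n ≡ᵇ n) ≡ true
≡ᵇ-refl n = det (T-reflects (n ≡ᵇ n)) (ofʸ (≡⇒≡ᵇ n n refl))

≡ᵇ-false : ∀ {m n} → m ≢ n → (m ≡ᵇ n) ≡ false
≡ᵇ-false {m} {n} m≢n = det (T-reflects (m ≡ᵇ n)) (ofⁿ (m≢n ∘ ≡ᵇ⇒≡ m n))

≢suc⇒≤⊎> : ∀ {x k} → suc k ≢ x → x ≤ k ⊎ suc k < x
≢suc⇒≤⊎> {x} {k} 1+k≢x with x ≤? k
... | yes x≤k = inj₁ x≤k
... | no x≰k = inj₂ (≤∧≢⇒< (≰⇒> x≰k) 1+k≢x)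

-- relInvB k x y is the majority vote of the three conditions x ≤ k, y < x, k < y.
majority : Bool → Bool → Bool → Bool
majority a b c = (a ∧ b) ∨ (b ∧ c) ∨ (c ∧ a)

relInvB-majority : ∀ k x y {a b c} → (x ≤ᵇ k) ≡ a → (y <ᵇ x) ≡ b → (k <ᵇ y) ≡ c →
  relInvB k x y ≡ majority a b c
relInvB-majority k x y refl refl refl = refl

majority-false-true : ∀ b → majority false b true ≡ b
majority-false-true true = refl
majority-false-true false = refl

majority-true-false : ∀ b → majority true b false ≡ b
majority-true-false true = refl
majority-true-false false = refl

≤ᵇ-pred : ∀ {x k} → suc k ≢ x → (x ≤ᵇ k) ≡ (x ≤ᵇ suc k)
≤ᵇ-pred 1+k≢x with ≢suc⇒≤⊎> 1+k≢x
... | inj₁ x≤k = trans (≤ᵇ-true x≤k) (sym (≤ᵇ-true (m≤n⇒m≤1+n x≤k)))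
... | inj₂ 1+k<x = trans (≤ᵇ-false (<-trans (n<1+n _) 1+k<x)) (sym (≤ᵇ-false 1+k<x))

<ᵇ-pred : ∀ {y k} → suc k ≢ y → (k <ᵇ y) ≡ (suc k <ᵇ y)
<ᵇ-pred 1+k≢y with ≢suc⇒≤⊎> 1+k≢y
... | inj₁ y≤k = trans (<ᵇ-false y≤k) (sym (<ᵇ-false (m≤n⇒m≤1+n y≤k)))
... | inj₂ 1+k<y = trans (<ᵇ-true (<-trans (n<1+n _) 1+k<y)) (sym (<ᵇ-true 1+k<y))

relInvB-suc : ∀ {k x y} → suc k ≢ x → suc k ≢ y → relInvB k x y ≡ relInvB (suc k) x y
relInvB-suc {k} {x} {y} 1+k≢x 1+k≢y = relInvB-majority k x y (≤ᵇ-pred 1+k≢x) refl (<ᵇ-pred 1+k≢y)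

relInvB-before-suc : ∀ {k x} → suc k ≢ x → relInvB k x (suc k) ≡ true
relInvB-before-suc {k} {x} 1+k≢x with ≢suc⇒≤⊎> 1+k≢x
... | inj₁ x≤k = relInvB-majority k x (suc k)
    (≤ᵇ-true x≤k) (<ᵇ-false (m≤n⇒m≤1+n x≤k)) (<ᵇ-true (n<1+n k))
... | inj₂ 1+k<x = relInvB-majority k x (suc k)
    (≤ᵇ-false (<-trans (n<1+n k) 1+k<x)) (<ᵇ-true 1+k<x) (<ᵇ-true (n<1+n k))

relInvB-after-suc : ∀ {k y} → suc k ≢ y → relInvB k (suc k) y ≡ false
relInvB-after-suc {k} {y} 1+k≢y with ≢suc⇒≤⊎> 1+k≢y
... | inj₁ y≤k = relInvB-majority k (suc k) y
    (≤ᵇ-false (n<1+n k)) (<ᵇ-true (s≤s y≤k)) (<ᵇ-false y≤k)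
... | inj₂ 1+k<y = relInvB-majority k (suc k) y
    (≤ᵇ-false (n<1+n k)) (<ᵇ-false (<⇒≤ 1+k<y)) (<ᵇ-true (<-trans (n<1+n k) 1+k<y))

relInvB-suc-before-suc : ∀ {k x} → suc k ≢ x → relInvB (suc k) x (suc k) ≡ false
relInvB-suc-before-suc {k} {x} 1+k≢x with ≢suc⇒≤⊎> 1+k≢x
... | inj₁ x≤k = relInvB-majority (suc k) x (suc k)
    (≤ᵇ-true (m≤n⇒m≤1+n x≤k)) (<ᵇ-false (m≤n⇒m≤1+n x≤k)) (<ᵇ-false (≤-refl {suc k}))
... | inj₂ 1+k<x = relInvB-majority (suc k) x (suc k)
    (≤ᵇ-false 1+k<x) (<ᵇ-true 1+k<x) (<ᵇ-false (≤-refl {suc k}))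

relInvB-suc-after-suc : ∀ {k y} → suc k ≢ y → relInvB (suc k) (suc k) y ≡ true
relInvB-suc-after-suc {k} {y} 1+k≢y with ≢suc⇒≤⊎> 1+k≢y
... | inj₁ y≤k = relInvB-majority (suc k) (suc k) y
    (≤ᵇ-true (≤-refl {suc k})) (<ᵇ-true (s≤s y≤k)) (<ᵇ-false (m≤n⇒m≤1+n y≤k))
... | inj₂ 1+k<y = relInvB-majority (suc k) (suc k) y
    (≤ᵇ-true (≤-refl {suc k})) (<ᵇ-false (<⇒≤ 1+k<y)) (<ᵇ-true 1+k<y)

relInvB-zero : ∀ {x y} → 1 ≤ x → 1 ≤ y → relInvB 0 x y ≡ (y <ᵇ x)
relInvB-zero {suc x} {suc y} _ _ = majority-false-true (suc y <ᵇ suc x)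

relInvB-≥ : ∀ {n x y} → x ≤ n → y ≤ n → relInvB n x y ≡ (y <ᵇ x)
relInvB-≥ {n} {x} {y} x≤n y≤n =
  trans (relInvB-majority n x y (≤ᵇ-true x≤n) refl (<ᵇ-false y≤n))
    (majority-true-false (y <ᵇ x))

countB-++ : ∀ p xs ys → countB p (xs ++ ys) ≡ countB p xs + countB p ys
countB-++ p [] ys = refl
countB-++ p (x ∷ xs) ys =
  trans (cong ((if p x then 1 else 0) +_) (countB-++ p xs ys)) (sym (+-assoc (if p x then 1 else 0) _ _))

countB-all-true : ∀ {p xs} → All (λ x → p x ≡ true) xs → countB p xs ≡ length xs
countB-all-true [] = refl
countB-all-true (px ∷ pxs) rewrite px = cong suc (countB-all-true pxs)

countB-all-false : ∀ {p xs} → All (λ x → p x ≡ false) xs → countB p xs ≡ 0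
countB-all-false [] = refl
countB-all-false (px ∷ pxs) rewrite px = countB-all-false pxs

countB-cong : ∀ {p q xs} → All (λ x → p x ≡ q x) xs → countB p xs ≡ countB q xs
countB-cong [] = refl
countB-cong {p} {q} {x ∷ xs} (px ∷ pxs) rewrite px = cong (_ +_) (countB-cong pxs)

inversions : (ℕ → ℕ → Bool) → List ℕ → ℕ
inversions r [] = 0
inversions r (x ∷ xs) = countB (r x) xs + inversions r xs

invK-inversions : ∀ k xs → invK k xs ≡ inversions (relInvB k) xs
invK-inversions k [] = refl
invK-inversions k (x ∷ xs) = cong (countB (relInvB k x) xs +_) (invK-inversions k xs)

inv-inversions : ∀ xs → inv xs ≡ inversions (λ x y → y <ᵇ x) xs
inv-inversions [] = refl
inv-inversions (x ∷ xs) = cong (countB (λ y → y <ᵇ x) xs +_) (inv-inversions xs)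

inversions-cong : ∀ {P : ℕ → Set} {r s xs} → All P xs → (∀ {x y} → P x → P y → r x y ≡ s x y) →
  inversions r xs ≡ inversions s xs
inversions-cong [] r≗s = refl
inversions-cong (px ∷ pxs) r≗s =
  cong₂ _+_ (countB-cong (All.map (r≗s px) pxs)) (inversions-cong pxs r≗s)

inversions-++-∷ : ∀ r u i v →
  inversions r (u ++ i ∷ v) ≡ inversions r (u ++ v) + countB (λ x → r x i) u + countB (r i) v
inversions-++-∷ r [] i v =
  trans (+-comm (countB (r i) v) _) (cong (_+ countB (r i) v) (sym (+-identityʳ _)))
inversions-++-∷ r (x ∷ u) i v
  rewrite countB-++ (r x) u (i ∷ v) | countB-++ (r x) u v | inversions-++-∷ r u i v =
  rearrange (countB (r x) u) (if r x i then 1 else 0) (countB (r x) v)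
            (inversions r (u ++ v)) (countB (λ y → r y i) u) (countB (r i) v)
  where
  open +-*-Solver
  rearrange : ∀ a b c d e f → a + (b + c) + (d + e + f) ≡ a + c + d + (b + e) + f
  rearrange = solve 6 (λ a b c d e f → a :+ (b :+ c) :+ (d :+ e :+ f) := a :+ c :+ d :+ (b :+ e) :+ f) refl

fillB-≢ : ∀ {i x} xs y ys → i ≢ x → fillB i (x ∷ xs) (y ∷ ys) ≡ y ∷ fillB i xs ys
fillB-≢ {i} {x} xs y ys i≢x rewrite ≡ᵇ-false {x} {i} (i≢x ∘ sym) = refl

fillB-≡ : ∀ i xs rest → fillB i (i ∷ xs) rest ≡ i ∷ fillB i xs rest
fillB-≡ i xs rest rewrite ≡ᵇ-refl i = refl

fillB-all-≢ : ∀ {i xs ys} → All (i ≢_) xs → length xs ≡ length ys → fillB i xs ys ≡ ys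
fillB-all-≢ {xs = []} {[]} [] _ = refl
fillB-all-≢ {xs = x ∷ xs} {y ∷ ys} (i≢x ∷ pxs) eq =
  trans (fillB-≢ xs y ys i≢x) (cong (y ∷_) (fillB-all-≢ pxs (suc-injective eq)))

fillB-++ : ∀ {i xs} zs c d → All (i ≢_) xs → length xs ≡ length c →
  fillB i (xs ++ zs) (c ++ d) ≡ c ++ fillB i zs d
fillB-++ {xs = []} zs [] d [] _ = refl
fillB-++ {xs = x ∷ xs} zs (y ∷ c) d (i≢x ∷ pxs) eq =
  trans (fillB-≢ (xs ++ zs) y (c ++ d) i≢x) (cong (y ∷_) (fillB-++ zs c d pxs (suc-injective eq)))

filter-≢ : ∀ i xs → All (i ≢_) xs → filter (λ x → T? (not (x ≡ᵇ i))) xs ≡ xs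
filter-≢ i xs pxs = filter-all (λ x → T? (not (x ≡ᵇ i))) (All.map kept pxs)
  where
  kept : ∀ {x} → i ≢ x → T (not (x ≡ᵇ i))
  kept {x} i≢x = Equivalence.from T-not-≡ (≡ᵇ-false (i≢x ∘ sym))

filter-++-∷ : ∀ i a b → All (i ≢_) (a ++ b) →
  filter (λ x → T? (not (x ≡ᵇ i))) (a ++ i ∷ b) ≡ a ++ b
filter-++-∷ i a b pab = begin
  filter keep? (a ++ i ∷ b)               ≡⟨ filter-++ keep? a (i ∷ b) ⟩
  filter keep? a ++ filter keep? (i ∷ b)  ≡⟨ cong (filter keep? a ++_) (filter-reject keep? {i} {b} dropped) ⟩
  filter keep? a ++ filter keep? b        ≡⟨ cong₂ _++_ (filter-≢ i a (++⁻ˡ a pab)) (filter-≢ i b (++⁻ʳ a pab)) ⟩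
  a ++ b                                  ∎
  where
  open ≡-Reasoning
  keep? : (x : ℕ) → Dec (T (not (x ≡ᵇ i)))
  keep? x = T? (not (x ≡ᵇ i))
  dropped : ¬ T (not (i ≡ᵇ i))
  dropped = subst (λ b → ¬ T (not b)) (sym (≡ᵇ-refl i)) (λ ())

reverse-++-∷ : ∀ {A : Set} (a : List A) i b → reverse (a ++ i ∷ b) ≡ reverse b ++ i ∷ reverse a
reverse-++-∷ a i b = begin
  reverse (a ++ i ∷ b)               ≡⟨ reverse-++ a (i ∷ b) ⟩
  reverse (i ∷ b) ++ reverse a       ≡⟨ cong (_++ reverse a) (unfold-reverse i b) ⟩
  (reverse b ++ [ i ]) ++ reverse a  ≡⟨ ++-assoc (reverse b) [ i ] (reverse a) ⟩
  reverse b ++ i ∷ reverse a         ∎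
  where open ≡-Reasoning

All-reverse : ∀ {A : Set} {P : A → Set} {xs : List A} → All P xs → All P (reverse xs)
All-reverse {xs = xs} = All-resp-↭ (↭-sym (↭-reverse xs))

++-length-complement : ∀ {A : Set} (a b c d : List A) → c ++ d ≡ a ++ b → length c ≡ length b →
  length d ≡ length a
++-length-complement a b c d eq |c|≡|b| = +-cancelˡ-≡ (length c) _ _ (begin
  length c + length d  ≡⟨ sym (length-++ c) ⟩
  length (c ++ d)      ≡⟨ cong length eq ⟩
  length (a ++ b)      ≡⟨ length-++ a ⟩
  length a + length b  ≡⟨ +-comm (length a) (length b) ⟩
  length b + length a  ≡⟨ cong (_+ length a) (sym |c|≡|b|) ⟩
  length c + length a  ∎)
  where open ≡-Reasoning

split-at-length : ∀ {A : Set} n (xs : List A) → n ≤ length xs →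
  ∃₂ λ ys zs → ys ++ zs ≡ xs × length ys ≡ n
split-at-length zero xs _ = [] , xs , refl , refl
split-at-length (suc n) (x ∷ xs) (s≤s n≤|xs|) with split-at-length n xs n≤|xs|
... | ys , zs , refl , refl = x ∷ ys , zs , refl , refl

B-absent : ∀ {i w} → All (i ≢_) w → B i w ≡ w
B-absent {i} {w} pw rewrite filter-≢ i w pw = fillB-all-≢ (All-reverse pw) (length-reverse w)

B-mirror : ∀ {i} a b c d → All (i ≢_) (a ++ b) → c ++ d ≡ a ++ b → length c ≡ length b →
  B i (a ++ i ∷ b) ≡ c ++ i ∷ d
B-mirror {i} a b c d pab cd≡ab |c|≡|b| = begin
  fillB i (reverse (a ++ i ∷ b)) (filter _ (a ++ i ∷ b))
    ≡⟨ cong₂ (fillB i) (reverse-++-∷ a i b) (trans (filter-++-∷ i a b pab) (sym cd≡ab)) ⟩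
  fillB i (reverse b ++ i ∷ reverse a) (c ++ d)
    ≡⟨ fillB-++ (i ∷ reverse a) c d (All-reverse (++⁻ʳ a pab)) (trans (length-reverse b) (sym |c|≡|b|)) ⟩
  c ++ fillB i (i ∷ reverse a) d
    ≡⟨ cong (c ++_) (fillB-≡ i (reverse a) d) ⟩
  c ++ i ∷ fillB i (reverse a) d
    ≡⟨ cong (λ z → c ++ i ∷ z) (fillB-all-≢ (All-reverse (++⁻ˡ a pab)) |rev-a|≡|d|) ⟩
  c ++ i ∷ d ∎
  where
  open ≡-Reasoning
  |rev-a|≡|d| : length (reverse a) ≡ length d
  |rev-a|≡|d| = trans (length-reverse a) (sym (++-length-complement a b c d cd≡ab |c|≡|b|))

mirror : ∀ {A : Set} (a b : List A) → ∃₂ λ c d → c ++ d ≡ a ++ b × length c ≡ length b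
mirror a b = split-at-length (length b) (a ++ b)
  (subst (length b ≤_) (sym (length-++ a)) (m≤n+m (length b) (length a)))

data Occurrence (i : ℕ) : List ℕ → Set where
  absent : ∀ {w} → All (i ≢_) w → Occurrence i w
  once : ∀ a b → All (i ≢_) (a ++ b) → Occurrence i (a ++ i ∷ b)

occurrence : ∀ i {w} → Unique w → Occurrence i w
occurrence i {w} unique-w with i ∈? w
... | no i∉w = absent (¬Any⇒All¬ w i∉w)
... | yes i∈w with ∈-∃++ i∈w
...   | a , b , refl with Unique-resp-↭ (setoid ℕ) (↭⇒↭ₛ (shift i a b)) unique-w
...     | i∉a++b ∷ _ = once a b i∉a++b

B-↭ : ∀ i {w} → Unique w → B i w ↭ w
B-↭ i unique-w with occurrence i unique-w
... | absent pw = ↭-reflexive (B-absent pw)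
... | once a b pab with mirror a b
...   | c , d , cd≡ab , |c|≡|b| = begin
  B i (a ++ i ∷ b)  ≡⟨ B-mirror a b c d pab cd≡ab |c|≡|b| ⟩
  c ++ i ∷ d        ↭⟨ shift i c d ⟩
  i ∷ c ++ d        ≡⟨ cong (i ∷_) cd≡ab ⟩
  i ∷ a ++ b        ↭⟨ shift i a b ⟨
  a ++ i ∷ b        ∎
  where open PermutationReasoning

B-involutive : ∀ i {w} → Unique w → B i (B i w) ≡ w
B-involutive i unique-w with occurrence i unique-w
... | absent pw = trans (cong (B i) (B-absent pw)) (B-absent pw)
... | once a b pab with mirror a b
...   | c , d , cd≡ab , |c|≡|b| = begin
  B i (B i (a ++ i ∷ b))  ≡⟨ cong (B i) (B-mirror a b c d pab cd≡ab |c|≡|b|) ⟩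
  B i (c ++ i ∷ d)        ≡⟨ B-mirror c d a b (subst (All (i ≢_)) (sym cd≡ab) pab) (sym cd≡ab) |a|≡|d| ⟩
  a ++ i ∷ b              ∎
  where
  open ≡-Reasoning
  |a|≡|d| : length a ≡ length d
  |a|≡|d| = sym (++-length-complement a b c d cd≡ab |c|≡|b|)

B-injective : ∀ i {u v} → Unique u → Unique v → B i u ≡ B i v → u ≡ v
B-injective i {u} {v} unique-u unique-v Bu≡Bv = begin
  u              ≡⟨ B-involutive i unique-u ⟨
  B i (B i u)    ≡⟨ cong (B i) Bu≡Bv ⟩
  B i (B i v)    ≡⟨ B-involutive i unique-v ⟩
  v              ∎
  where open ≡-Reasoning

invK-++-suc-∷ : ∀ k a b → All (suc k ≢_) (a ++ b) →
  invK k (a ++ suc k ∷ b) ≡ inversions (relInvB (suc k)) (a ++ b) + length a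
invK-++-suc-∷ k a b pab = begin
  invK k (a ++ suc k ∷ b)
    ≡⟨ invK-inversions k (a ++ suc k ∷ b) ⟩
  inversions (relInvB k) (a ++ suc k ∷ b)
    ≡⟨ inversions-++-∷ (relInvB k) a (suc k) b ⟩
  inversions (relInvB k) (a ++ b) + countB (λ x → relInvB k x (suc k)) a + countB (relInvB k (suc k)) b
    ≡⟨ cong₂ _+_ (cong₂ _+_ (inversions-cong pab relInvB-suc)
                            (countB-all-true (All.map relInvB-before-suc pa)))
                 (countB-all-false (All.map relInvB-after-suc pb)) ⟩
  inversions (relInvB (suc k)) (a ++ b) + length a + 0
    ≡⟨ +-identityʳ _ ⟩
  inversions (relInvB (suc k)) (a ++ b) + length a ∎
  where
  open ≡-Reasoning
  pa : All (suc k ≢_) a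
  pa = ++⁻ˡ a pab
  pb : All (suc k ≢_) b
  pb = ++⁻ʳ a pab

invK-suc-++-suc-∷ : ∀ k a b → All (suc k ≢_) (a ++ b) →
  invK (suc k) (a ++ suc k ∷ b) ≡ inversions (relInvB (suc k)) (a ++ b) + length b
invK-suc-++-suc-∷ k a b pab = begin
  invK (suc k) (a ++ suc k ∷ b)
    ≡⟨ invK-inversions (suc k) (a ++ suc k ∷ b) ⟩
  inversions (relInvB (suc k)) (a ++ suc k ∷ b)
    ≡⟨ inversions-++-∷ (relInvB (suc k)) a (suc k) b ⟩
  inversions (relInvB (suc k)) (a ++ b)
    + countB (λ x → relInvB (suc k) x (suc k)) a + countB (relInvB (suc k) (suc k)) b
    ≡⟨ cong₂ _+_ (cong (inversions (relInvB (suc k)) (a ++ b) +_)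
                       (countB-all-false (All.map relInvB-suc-before-suc pa)))
                 (countB-all-true (All.map relInvB-suc-after-suc pb)) ⟩
  inversions (relInvB (suc k)) (a ++ b) + 0 + length b
    ≡⟨ cong (_+ length b) (+-identityʳ _) ⟩
  inversions (relInvB (suc k)) (a ++ b) + length b ∎
  where
  open ≡-Reasoning
  pa : All (suc k ≢_) a
  pa = ++⁻ˡ a pab
  pb : All (suc k ≢_) b
  pb = ++⁻ʳ a pab

invK-B-suc : ∀ k {w} → Unique w → invK k w ≡ invK (suc k) (B (suc k) w)
invK-B-suc k unique-w with occurrence (suc k) unique-w
... | absent {w} pw = begin
  invK k w                        ≡⟨ invK-inversions k w ⟩
  inversions (relInvB k) w        ≡⟨ inversions-cong pw relInvB-suc ⟩
  inversions (relInvB (suc k)) w  ≡⟨ invK-inversions (suc k) w ⟨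
  invK (suc k) w                  ≡⟨ cong (invK (suc k)) (B-absent pw) ⟨
  invK (suc k) (B (suc k) w)      ∎
  where open ≡-Reasoning
... | once a b pab with mirror a b
...   | c , d , cd≡ab , |c|≡|b| = begin
  invK k (a ++ suc k ∷ b)
    ≡⟨ invK-++-suc-∷ k a b pab ⟩
  inversions (relInvB (suc k)) (a ++ b) + length a
    ≡⟨ cong₂ _+_ (cong (inversions (relInvB (suc k))) cd≡ab) (++-length-complement a b c d cd≡ab |c|≡|b|) ⟨
  inversions (relInvB (suc k)) (c ++ d) + length d
    ≡⟨ invK-suc-++-suc-∷ k c d (subst (All (suc k ≢_)) (sym cd≡ab) pab) ⟨
  invK (suc k) (c ++ suc k ∷ d)
    ≡⟨ cong (invK (suc k)) (B-mirror a b c d pab cd≡ab |c|≡|b|) ⟨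
  invK (suc k) (B (suc k) (a ++ suc k ∷ b)) ∎
  where open ≡-Reasoning

inv≡invK-zero : ∀ {w} → All (1 ≤_) w → inv w ≡ invK 0 w
inv≡invK-zero {w} pw = begin
  inv w                              ≡⟨ inv-inversions w ⟩
  inversions (λ x y → y <ᵇ x) w      ≡⟨ inversions-cong pw (λ 1≤x 1≤y → sym (relInvB-zero 1≤x 1≤y)) ⟩
  inversions (relInvB 0) w           ≡⟨ invK-inversions 0 w ⟨
  invK 0 w                           ∎
  where open ≡-Reasoning

inv≡invK-≥ : ∀ {n w} → All (_≤ n) w → inv w ≡ invK n w
inv≡invK-≥ {n} {w} pw = begin
  inv w                              ≡⟨ inv-inversions w ⟩
  inversions (λ x y → y <ᵇ x) w      ≡⟨ inversions-cong pw (λ x≤n y≤n → sym (relInvB-≥ x≤n y≤n)) ⟩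
  inversions (relInvB n) w           ≡⟨ invK-inversions n w ⟨
  invK n w                           ∎
  where open ≡-Reasoning

IsPerm⇒Unique : ∀ {n w} → IsPerm n w → Unique w
IsPerm⇒Unique {n} w↭ = Unique-resp-↭ (setoid ℕ) (↭⇒↭ₛ (↭-sym w↭)) (Unique-map⁺ suc-injective (upTo⁺ n))

IsPerm⇒All-between : ∀ {n w} → IsPerm n w → All (λ x → 1 ≤ x × x ≤ n) w
IsPerm⇒All-between {n} w↭ = All-resp-↭ (↭-sym w↭) (All.tabulate between)
  where
  between : ∀ {x} → x ∈ map suc (upTo n) → 1 ≤ x × x ≤ n
  between x∈ with ∈-map⁻ suc x∈
  ... | y , y∈ , refl = s≤s z≤n , ∈-upTo⁻ y∈

B-isPerm : ∀ {n} i {w} → IsPerm n w → IsPerm n (B i w)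
B-isPerm i w↭ = ↭-trans (B-↭ i (IsPerm⇒Unique w↭)) w↭

Bupto-isPerm : ∀ {n w} m → IsPerm n w → IsPerm n (Bupto m w)
Bupto-isPerm zero w↭ = w↭
Bupto-isPerm (suc m) w↭ = B-isPerm (suc m) (Bupto-isPerm m w↭)

invK-zero-Bupto : ∀ {n w} m → IsPerm n w → invK 0 w ≡ invK m (Bupto m w)
invK-zero-Bupto zero w↭ = refl
invK-zero-Bupto (suc m) w↭ =
  trans (invK-zero-Bupto m w↭) (invK-B-suc m (IsPerm⇒Unique (Bupto-isPerm m w↭)))

inv-Bupto : ∀ {n w} → IsPerm n w → inv w ≡ inv (Bupto n w)
inv-Bupto {n} {w} w↭ = begin
  inv w               ≡⟨ inv≡invK-zero (All.map proj₁ (IsPerm⇒All-between w↭)) ⟩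
  invK 0 w            ≡⟨ invK-zero-Bupto n w↭ ⟩
  invK n (Bupto n w)  ≡⟨ inv≡invK-≥ (All.map proj₂ (IsPerm⇒All-between (Bupto-isPerm n w↭))) ⟨
  inv (Bupto n w)     ∎
  where open ≡-Reasoning

mainTheorem2 : (n : ℕ) → 1 ≤ n →
    ((i : ℕ) → 1 ≤ i →
      ((w : List ℕ) → IsPerm n w → IsPerm n (B i w))
      × ((u v : List ℕ) → IsPerm n u → IsPerm n v → B i u ≡ B i v → u ≡ v)
      × ((v : List ℕ) → IsPerm n v → Σ (List ℕ) (λ u → IsPerm n u × B i u ≡ v)))
    × ((w : List ℕ) → IsPerm n w → (k : ℕ) → invK k w ≡ invK (suc k) (B (suc k) w))
    × ((w : List ℕ) → IsPerm n w → inv w ≡ inv (Bupto n w))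
mainTheorem2 n _ =
  (λ i _ → (λ w → B-isPerm i)
         , (λ u v u↭ v↭ → B-injective i (IsPerm⇒Unique u↭) (IsPerm⇒Unique v↭))
         , (λ v v↭ → B i v , B-isPerm i v↭ , B-involutive i (IsPerm⇒Unique v↭)))
  , (λ w w↭ k → invK-B-suc k (IsPerm⇒Unique w↭))
  , (λ w → inv-Bupto)
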